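{- For every integer $k\ge 3$ and every integer $n\ge 1$, $$\mathrm{LS}_n(12\dots k)=1+\sum_{i=1}^{k-2}\frac{1}{[i-1]_q!}\,c_{k-i+1}\,K_{i,n}.$$
   Context: A restricted growth function (RGF) of length $n$ is a sequence $w=w_1\dots w_n$ of positive integers with $w_1=1$ and $w_i\le 1+\max\{w_1,\dots,w_{i-1}\}$ for $i\ge 2$; $R_n$ is the set of RGFs of length $n$. The standardization of a word replaces every occurrence of its smallest letter by $1$, of its next smallest letter by $2$, and so on. An RGF $w$ contains an RGF $v$ if some subword (subsequence, not necessarily consecutive) of $w$ standardizes to $v$; otherwise $w$ avoids $v$. $R_n(v)$ is the set of $w\in R_n$ avoiding $v$; $12\dots k$ is the RGF with $w_i=i$ for $1\le i\le k$. For a word $w$ and position $j$, $\mathrm{ls}(w_j)$ is the number of distinct values $w_i$ with $i<j$ and $w_i<w_j$, and $\mathrm{ls}(w)=\sum_j\mathrm{ls}(w_j)$; $\mathrm{LS}_n(v)=\sum_{w\in R_n(v)}q^{\mathrm{ls}(w)}$. Notation: $[m]_q=1+q+\dots+q^{m-1}$, $[m]_q!=[1]_q\cdots[m]_q$ with $[0]_q!=1$; $K_{m,n}=\dfrac{[m+1]_q^{\,n-1}-1}{[m]_q}$; and for $k\ge 3$, $c_k=1-\sum_{j=1}^{k-3}\frac{1}{[j]_q!}c_{k-j}$ (so $c_3=1$). -}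

module Defs where

open import Data.Nat as ℕ using (ℕ; zero; suc; _⊔_; _∸_; _<?_)
open import Data.Nat.Properties as ℕP using ()
open import Data.List using (List; []; _∷_; map; length; filter; upTo; _++_; [_])
open import Data.List.Membership.DecPropositional ℕP._≟_ using (_∈?_)
open import Data.List.Relation.Binary.Sublist.Propositional using (_⊆_)
open import Data.Product using (_×_; ∃)
open import Data.Unit using (⊤)
open import Relation.Binary.PropositionalEquality using (_≡_)
open import Relation.Nullary using (¬_; yes; no)
open import Data.Rational as ℚ using (ℚ; 0ℚ; 1ℚ; _+_; _*_; _-_; 1/_)
open import Data.Rational.Properties as ℚP using ()

-- RGFFrom m w : w continues an RGF whose prefix so far has maximum m
-- (m = 0 for the empty prefix): each letter x is positive and x ≤ 1 + m.
RGFFrom : ℕ → List ℕ → Set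
RGFFrom m []       = ⊤
RGFFrom m (x ∷ xs) = (1 ℕ.≤ x) × (x ℕ.≤ suc m) × RGFFrom (m ⊔ x) xs

IsRGF : List ℕ → Set
IsRGF w = RGFFrom 0 w

distinctBelow : List ℕ → ℕ → ℕ
distinctBelow p x = length (filter (λ y → y ∈? p) (upTo x))

standardize : List ℕ → List ℕ
standardize s = map (λ x → suc (distinctBelow s x)) s

Contains : List ℕ → List ℕ → Set
Contains w v = ∃ λ s → (s ⊆ w) × (standardize s ≡ v)

Avoids : List ℕ → List ℕ → Set
Avoids w v = ¬ Contains w v

incr : ℕ → List ℕ
incr k = map suc (upTo k)

lsFrom : List ℕ → List ℕ → ℕ
lsFrom p []       = 0
lsFrom p (x ∷ xs) = distinctBelow p x ℕ.+ lsFrom (p ++ [ x ]) xs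

ls : List ℕ → ℕ
ls w = lsFrom [] w

-- total inverse (x⁻¹ for x ≠ 0; only ever applied to nonzero values
-- in the theorem, since all denominators are ≥ 1 for q ≥ 0)
inv : ℚ → ℚ
inv x with x ℚP.≟ 0ℚ
... | yes _  = 0ℚ
... | no x≢0 = (1/ x) {{ℚ.≢-nonZero x≢0}}

sumℚ : List ℚ → ℚ
sumℚ []       = 0ℚ
sumℚ (x ∷ xs) = x + sumℚ xs

_^_ : ℚ → ℕ → ℚ
q ^ zero  = 1ℚ
q ^ suc n = q * (q ^ n)

Σ₁ : ℕ → (ℕ → ℚ) → ℚ
Σ₁ zero    f = 0ℚ
Σ₁ (suc m) f = Σ₁ m f + f (suc m)

qint : ℚ → ℕ → ℚ
qint q m = sumℚ (map (q ^_) (upTo m))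

qfact : ℚ → ℕ → ℚ
qfact q zero    = 1ℚ
qfact q (suc m) = qfact q m * qint q (suc m)

K : ℚ → ℕ → ℕ → ℚ
K q m n = ((qint q (suc m) ^ (n ∸ 1)) - 1ℚ) * inv (qint q m)

-- c_k = 1 - Σ_{j=1}^{k-3} c_{k-j} / [j]_q!   (k ≥ 3), computed with a
-- fuel argument; c q k = cFuel q k k, and fuel k is always sufficient
-- (each recursive call lowers both fuel and index, index ≤ fuel).
cFuel : ℚ → ℕ → ℕ → ℚ
cFuel q zero    k = 0ℚ
cFuel q (suc f) k = 1ℚ - Σ₁ (k ∸ 3) (λ j → cFuel q f (k ∸ j) * inv (qfact q j))

c : ℚ → ℕ → ℚ
c q k = cFuel q k k

-- LS_n(v) = Σ_{w ∈ R_n(v)} q^{ls(w)}, summed over a duplicate-free list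
-- enumerating R_n(v)
LSsum : ℚ → List (List ℕ) → ℚ
LSsum q L = sumℚ (map (λ w → q ^ ls w) L)

RHS : ℚ → ℕ → ℕ → ℚ
RHS q k n = 1ℚ + Σ₁ (k ∸ 2) (λ i → inv (qfact q (i ∸ 1)) * c q (suc (k ∸ i)) * K q i n)

-- An RGF avoids 12…k exactly when all its letters are at most k − 1, and after a prefix with value set
-- {1, …, m} a letter x ≤ m + 1 has ls = x − 1. So LS_n(12…k) = G (k − 1) 0 n, where G d m n sums q^ls over
-- the continuations of length n of a prefix with maximum m whose letters stay ≤ m + d; by the choice of the
-- next letter, G d m (n + 1) = [m] G d m n + q^m G (d − 1) (m + 1) n. From this one derives a recurrence in n
-- with d and m fixed, and the closed form satisfies it by induction on n. That step uses
-- K_{i+1,n+2} = [i+2] K_{i+1,n+1} + q and two facts about c_{s+3}: its defining relation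
-- Σ_{j≤s} c_{s+3−j}/[j]! = 1, and [s] c_{s+3} = Σ_{u<s−1} q^{u+1} c_{u+3}, which holds because both sides
-- have the same convolution with q^j/[j]!.

module Submission where

open import Defs
open import Data.Nat as ℕ using (ℕ; zero; suc; pred; _∸_; z≤n; s≤s)
  renaming (_+_ to _+ℕ_; _≤_ to _≤ℕ_; _<_ to _<ℕ_)
import Data.Nat.Properties as ℕP
open import Data.Rational as ℚ using (ℚ; 0ℚ; 1ℚ; _+_; _*_; _-_; Positive; NonNegative)
  renaming (_≤_ to _≤ℚ_)
import Data.Rational.Properties as ℚP
open import Data.Rational.Solver using (module +-*-Solver)
open +-*-Solver using (solve; _:+_; _:*_; _:-_; _:=_; con)
open import Data.List
  using (List; []; _∷_; [_]; _++_; map; upTo; applyUpTo; length; filter; iterate; cartesianProductWith)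
import Data.List.Properties as LP
open import Data.List.Membership.Propositional using (_∈_; _∉_)
open import Data.List.Membership.Propositional.Properties
  using ( ∈-map⁺; ∈-map⁻; ∈-++⁺ˡ; ∈-++⁺ʳ; ∈-++⁻; ∈-upTo⁺; ∈-upTo⁻
        ; ∈-cartesianProductWith⁺; ∈-cartesianProductWith⁻)
open import Data.List.Membership.DecPropositional ℕP._≟_ using (_∈?_)
open import Data.List.Relation.Unary.All as All using (All; []; _∷_)
open import Data.List.Relation.Unary.All.Properties using (¬All⇒Any¬) renaming (map⁺ to All-map⁺)
open import Data.List.Relation.Unary.Any as Any using (Any; here; there)
open import Data.List.Relation.Unary.AllPairs using ([]; _∷_)
open import Data.List.Relation.Unary.Unique.Propositional using (Unique)
import Data.List.Relation.Unary.Unique.Propositional.Properties as UP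
open import Data.List.Relation.Binary.Permutation.Propositional
  using (_↭_; prep; swap) renaming (refl to ↭-refl; trans to ↭-trans)
open import Data.List.Relation.Binary.BagAndSetEquality using (∼bag⇒↭)
open import Data.List.Membership.Propositional.Properties.WithK using (unique∧set⇒bag)
open import Data.List.Relation.Binary.Sublist.Propositional using (_⊆_; _∷_; _∷ʳ_; minimum)
open import Data.List.Relation.Binary.Sublist.Propositional.Properties using (All-resp-⊆)
open import Data.Product using (_×_; _,_; proj₁; proj₂; map₂; ∃)
open import Data.Sum using (inj₁; inj₂)
open import Function using (_∘_)
open import Function.Bundles using (_⇔_; mk⇔; Equivalence)
import Function.Properties.Equivalence as ⇔
open import Data.Empty using (⊥-elim)
open import Data.Nat.Induction using (<-rec)
open import Algebra.Properties.Group ℚP.+-0-group using () renaming (∙-cancelʳ to +-cancelʳ)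
open import Relation.Nullary using (¬_; yes; no)
open import Relation.Binary.PropositionalEquality hiding ([_])
open ≡-Reasoning

Σ< : ℕ → (ℕ → ℚ) → ℚ
Σ< zero    f = 0ℚ
Σ< (suc n) f = Σ< n f + f n

Σ<-cong : ∀ n {f g : ℕ → ℚ} → (∀ i → i <ℕ n → f i ≡ g i) → Σ< n f ≡ Σ< n g
Σ<-cong zero    f≗g = refl
Σ<-cong (suc n) f≗g =
  cong₂ _+_ (Σ<-cong n (λ i i<n → f≗g i (ℕP.m<n⇒m<1+n i<n))) (f≗g n (ℕP.n<1+n n))

Σ<-+ : ∀ n (f g : ℕ → ℚ) → Σ< n (λ i → f i + g i) ≡ Σ< n f + Σ< n g
Σ<-+ zero    f g = refl
Σ<-+ (suc n) f g = begin
  Σ< n (λ i → f i + g i) + (f n + g n) ≡⟨ cong (_+ (f n + g n)) (Σ<-+ n f g) ⟩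
  (Σ< n f + Σ< n g) + (f n + g n)      ≡⟨ solve 4 (λ a b c d → (a :+ b) :+ (c :+ d) := (a :+ c) :+ (b :+ d))
                                                  refl (Σ< n f) (Σ< n g) (f n) (g n) ⟩
  (Σ< n f + f n) + (Σ< n g + g n)      ∎

Σ<-*ˡ : ∀ n a (f : ℕ → ℚ) → Σ< n (λ i → a * f i) ≡ a * Σ< n f
Σ<-*ˡ zero    a f = sym (ℚP.*-zeroʳ a)
Σ<-*ˡ (suc n) a f = begin
  Σ< n (λ i → a * f i) + a * f n ≡⟨ cong (_+ a * f n) (Σ<-*ˡ n a f) ⟩
  a * Σ< n f + a * f n           ≡⟨ ℚP.*-distribˡ-+ a (Σ< n f) (f n) ⟨
  a * (Σ< n f + f n)             ∎

Σ<-zero : ∀ n → Σ< n (λ _ → 0ℚ) ≡ 0ℚ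
Σ<-zero zero    = refl
Σ<-zero (suc n) = cong (_+ 0ℚ) (Σ<-zero n)

Σ<-head : ∀ n (f : ℕ → ℚ) → Σ< (suc n) f ≡ f 0 + Σ< n (λ i → f (suc i))
Σ<-head zero    f = ℚP.+-comm 0ℚ (f 0)
Σ<-head (suc n) f = begin
  Σ< (suc n) f + f (suc n)                   ≡⟨ cong (_+ f (suc n)) (Σ<-head n f) ⟩
  (f 0 + Σ< n (λ i → f (suc i))) + f (suc n) ≡⟨ ℚP.+-assoc (f 0) _ _ ⟩
  f 0 + Σ< (suc n) (λ i → f (suc i))         ∎

Σ₁≡Σ< : ∀ m (f : ℕ → ℚ) → Σ₁ m f ≡ Σ< m (λ i → f (suc i))
Σ₁≡Σ< zero    f = refl
Σ₁≡Σ< (suc m) f = cong (_+ f (suc m)) (Σ₁≡Σ< m f)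

Σ<-triangle-antidiagonals : ∀ N (h : ℕ → ℕ → ℚ) →
  Σ< N (λ j → Σ< (N ∸ j) (h j)) ≡ Σ< N (λ r → Σ< (suc r) (λ j → h j (r ∸ j)))
Σ<-triangle-antidiagonals zero    h = refl
Σ<-triangle-antidiagonals (suc N) h = begin
  Σ< N (λ j → Σ< (suc N ∸ j) (h j)) + Σ< (suc N ∸ N) (h N)
    ≡⟨ cong₂ _+_ (Σ<-cong N (λ j j<N → cong (λ t → Σ< t (h j)) (ℕP.+-∸-assoc 1 (ℕP.<⇒≤ j<N))))
                 (cong (λ t → Σ< t (h N)) (ℕP.+-∸-assoc 1 (ℕP.≤-refl {N}))) ⟩
  Σ< N (λ j → Σ< (N ∸ j) (h j) + h j (N ∸ j)) + Σ< (suc (N ∸ N)) (h N)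
    ≡⟨ cong₂ _+_ (Σ<-+ N _ _) (cong (λ t → Σ< (suc t) (h N)) (ℕP.n∸n≡0 N)) ⟩
  (Σ< N (λ j → Σ< (N ∸ j) (h j)) + Σ< N (λ j → h j (N ∸ j))) + (0ℚ + h N 0)
    ≡⟨ cong (λ z → (z + Σ< N (λ j → h j (N ∸ j))) + (0ℚ + h N 0)) (Σ<-triangle-antidiagonals N h) ⟩
  (A + Σ< N (λ j → h j (N ∸ j))) + (0ℚ + h N 0)
    ≡⟨ solve 3 (λ a b c → (a :+ b) :+ (con 0ℚ :+ c) := a :+ (b :+ c))
             refl A (Σ< N (λ j → h j (N ∸ j))) (h N 0) ⟩
  A + (Σ< N (λ j → h j (N ∸ j)) + h N 0)
    ≡⟨ cong (λ t → A + (Σ< N (λ j → h j (N ∸ j)) + h N t)) (ℕP.n∸n≡0 N) ⟨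
  A + Σ< (suc N) (λ j → h j (N ∸ j)) ∎
  where A = Σ< N (λ r → Σ< (suc r) (λ j → h j (r ∸ j)))

Σ<-triangle-swap : ∀ N (g : ℕ → ℕ → ℚ) →
  Σ< N (λ a → Σ< a (g a)) ≡ Σ< N (λ i → Σ< (N ∸ suc i) (λ r → g (suc (i +ℕ r)) i))
Σ<-triangle-swap zero    g = refl
Σ<-triangle-swap (suc N) g = begin
  Σ< N (λ a → Σ< a (g a)) + Σ< N (g N)
    ≡⟨ cong₂ _+_ (Σ<-triangle-swap N g)
                 (Σ<-cong N (λ i i<N → cong (λ t → g t i) (sym (ℕP.m+[n∸m]≡n i<N)))) ⟩
  Σ< N (λ i → Σ< (N ∸ suc i) (F i)) + Σ< N (λ i → F i (N ∸ suc i))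
    ≡⟨ Σ<-+ N _ _ ⟨
  Σ< N (λ i → Σ< (suc (N ∸ suc i)) (F i))
    ≡⟨ Σ<-cong N (λ i i<N → cong (λ t → Σ< t (F i)) (ℕP.+-∸-assoc 1 i<N)) ⟨
  Σ< N (λ i → Σ< (suc N ∸ suc i) (F i))
    ≡⟨ ℚP.+-identityʳ _ ⟨
  Σ< N (λ i → Σ< (suc N ∸ suc i) (F i)) + 0ℚ
    ≡⟨ cong (λ t → Σ< N (λ i → Σ< (suc N ∸ suc i) (F i)) + Σ< t (F N)) (ℕP.n∸n≡0 N) ⟨
  Σ< N (λ i → Σ< (suc N ∸ suc i) (F i)) + Σ< (N ∸ N) (F N) ∎
  where
  F : ℕ → ℕ → ℚ
  F i r = g (suc (i +ℕ r)) i

_⋆_ : (ℕ → ℚ) → (ℕ → ℚ) → ℕ → ℚ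
(f ⋆ g) s = Σ< (suc s) (λ j → f j * g (s ∸ j))

⋆-cancelˡ : (g Y Z : ℕ → ℚ) → g 0 ≡ 1ℚ → (∀ s → (g ⋆ Y) s ≡ (g ⋆ Z) s) →
  ∀ s → Y s ≡ Z s
⋆-cancelˡ g Y Z g0≡1 g⋆Y≗g⋆Z = <-rec (λ s → Y s ≡ Z s) step
  where
  tail : (ℕ → ℚ) → ℕ → ℚ
  tail X t = Σ< t (λ j → g (suc j) * X (t ∸ suc j))
  step : ∀ t → (∀ {t′} → t′ <ℕ t → Y t′ ≡ Z t′) → Y t ≡ Z t
  step t ih = +-cancelʳ (tail Y t) (Y t) (Z t) (begin
    Y t + tail Y t       ≡⟨ cong (_+ tail Y t) (ℚP.*-identityˡ (Y t)) ⟨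
    1ℚ * Y t + tail Y t  ≡⟨ cong (λ a → a * Y t + tail Y t) g0≡1 ⟨
    g 0 * Y t + tail Y t ≡⟨ Σ<-head t _ ⟨
    (g ⋆ Y) t            ≡⟨ g⋆Y≗g⋆Z t ⟩
    (g ⋆ Z) t            ≡⟨ Σ<-head t _ ⟩
    g 0 * Z t + tail Z t ≡⟨ cong₂ (λ a b → a * Z t + b) g0≡1 (Σ<-cong t earlier) ⟩
    1ℚ * Z t + tail Y t  ≡⟨ cong (_+ tail Y t) (ℚP.*-identityˡ (Z t)) ⟩
    Z t + tail Y t       ∎)
    where
    earlier : ∀ j → j <ℕ t → g (suc j) * Z (t ∸ suc j) ≡ g (suc j) * Y (t ∸ suc j)
    earlier j j<t = cong (g (suc j) *_) (sym (ih (ℕP.∸-monoʳ-< (s≤s z≤n) j<t)))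

sumℚ-++ : ∀ xs ys → sumℚ (xs ++ ys) ≡ sumℚ xs + sumℚ ys
sumℚ-++ []       ys = sym (ℚP.+-identityˡ _)
sumℚ-++ (x ∷ xs) ys = trans (cong (x +_) (sumℚ-++ xs ys)) (sym (ℚP.+-assoc x _ _))

sumℚ-map-*ˡ : ∀ {A : Set} a (f : A → ℚ) xs → sumℚ (map (λ x → a * f x) xs) ≡ a * sumℚ (map f xs)
sumℚ-map-*ˡ a f []       = sym (ℚP.*-zeroʳ a)
sumℚ-map-*ˡ a f (x ∷ xs) =
  trans (cong (a * f x +_) (sumℚ-map-*ˡ a f xs)) (sym (ℚP.*-distribˡ-+ a (f x) (sumℚ (map f xs))))

sumℚ-map-cong : ∀ {A : Set} {f g : A → ℚ} xs → (∀ {x} → x ∈ xs → f x ≡ g x) →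
  sumℚ (map f xs) ≡ sumℚ (map g xs)
sumℚ-map-cong xs f≗g = cong sumℚ (LP.map-cong-local (All.tabulate f≗g))

sumℚ-cartesianProductWith : ∀ {A B C : Set} (F : C → ℚ) (f : A → B → C) xs ys →
  sumℚ (map F (cartesianProductWith f xs ys)) ≡ sumℚ (map (λ x → sumℚ (map (F ∘ f x) ys)) xs)
sumℚ-cartesianProductWith F f []       ys = refl
sumℚ-cartesianProductWith F f (x ∷ xs) ys = begin
  sumℚ (map F (map (f x) ys ++ cartesianProductWith f xs ys))
    ≡⟨ cong sumℚ (LP.map-++ F (map (f x) ys) _) ⟩
  sumℚ (map F (map (f x) ys) ++ map F (cartesianProductWith f xs ys))
    ≡⟨ sumℚ-++ (map F (map (f x) ys)) _ ⟩
  sumℚ (map F (map (f x) ys)) + sumℚ (map F (cartesianProductWith f xs ys))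
    ≡⟨ cong₂ _+_ (cong sumℚ (sym (LP.map-∘ ys))) (sumℚ-cartesianProductWith F f xs ys) ⟩
  sumℚ (map (F ∘ f x) ys) + sumℚ (map (λ x → sumℚ (map (F ∘ f x) ys)) xs) ∎

sumℚ-↭ : ∀ {A : Set} (f : A → ℚ) {xs ys} → xs ↭ ys → sumℚ (map f xs) ≡ sumℚ (map f ys)
sumℚ-↭ f ↭-refl                = refl
sumℚ-↭ f (prep x xs↭ys)        = cong (f x +_) (sumℚ-↭ f xs↭ys)
sumℚ-↭ f (swap {ys = ys} x y p) = trans (cong (λ t → f x + (f y + t)) (sumℚ-↭ f p))
  (solve 3 (λ a b c → a :+ (b :+ c) := b :+ (a :+ c)) refl (f x) (f y) (sumℚ (map f ys)))
sumℚ-↭ f (↭-trans p p′)        = trans (sumℚ-↭ f p) (sumℚ-↭ f p′)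

inv-inverseʳ : ∀ x → x ≢ 0ℚ → x * inv x ≡ 1ℚ
inv-inverseʳ x x≢0 with x ℚP.≟ 0ℚ
... | yes x≡0  = ⊥-elim (x≢0 x≡0)
... | no  x≢0′ = ℚP.*-inverseʳ x {{ℚ.≢-nonZero x≢0′}}

inv-unique : ∀ x y → x ≢ 0ℚ → x * y ≡ 1ℚ → y ≡ inv x
inv-unique x y x≢0 xy≡1 = begin
  y               ≡⟨ ℚP.*-identityʳ y ⟨
  y * 1ℚ          ≡⟨ cong (y *_) (inv-inverseʳ x x≢0) ⟨
  y * (x * inv x) ≡⟨ solve 3 (λ x y z → y :* (x :* z) := (x :* y) :* z) refl x y (inv x) ⟩
  (x * y) * inv x ≡⟨ cong (_* inv x) xy≡1 ⟩
  1ℚ * inv x      ≡⟨ ℚP.*-identityˡ (inv x) ⟩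
  inv x           ∎

*-inv-cancelˡ : ∀ a b → a ≢ 0ℚ → a * b ≢ 0ℚ → b * inv (a * b) ≡ inv a
*-inv-cancelˡ a b a≢0 ab≢0 =
  inv-unique a (b * inv (a * b)) a≢0 (trans (sym (ℚP.*-assoc a b _)) (inv-inverseʳ (a * b) ab≢0))

positive⇒≢0 : ∀ x → Positive x → x ≢ 0ℚ
positive⇒≢0 x x>0 x≡0 = ℚP.<⇒≢ (ℚP.positive⁻¹ x {{x>0}}) (sym x≡0)


Spans : List ℕ → ℕ → Set
Spans p m = ∀ y → y ∈ p ⇔ (1 ≤ℕ y × y ≤ℕ m)

Spans-[] : Spans [] 0
Spans-[] y = mk⇔ (λ ()) (λ { (1≤y , y≤0) → ⊥-elim (ℕP.<⇒≱ 1≤y y≤0) })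

Spans-∷ʳ-old : ∀ {p m x} → Spans p m → 1 ≤ℕ x → x ≤ℕ m → Spans (p ++ [ x ]) m
Spans-∷ʳ-old {p} {m} {x} sp 1≤x x≤m y = mk⇔ to (∈-++⁺ˡ ∘ Equivalence.from (sp y))
  where
  to : y ∈ p ++ [ x ] → 1 ≤ℕ y × y ≤ℕ m
  to y∈ with ∈-++⁻ p y∈
  ... | inj₁ y∈p        = Equivalence.to (sp y) y∈p
  ... | inj₂ (here refl) = 1≤x , x≤m

Spans-∷ʳ-new : ∀ {p m} → Spans p m → Spans (p ++ [ suc m ]) (suc m)
Spans-∷ʳ-new {p} {m} sp y = mk⇔ to from
  where
  to : y ∈ p ++ [ suc m ] → 1 ≤ℕ y × y ≤ℕ suc m
  to y∈ with ∈-++⁻ p y∈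
  ... | inj₁ y∈p        = map₂ ℕP.m≤n⇒m≤1+n (Equivalence.to (sp y) y∈p)
  ... | inj₂ (here refl) = s≤s z≤n , ℕP.≤-refl
  from : 1 ≤ℕ y × y ≤ℕ suc m → y ∈ p ++ [ suc m ]
  from (1≤y , y≤1+m) with ℕP.m≤n⇒m<n∨m≡n y≤1+m
  ... | inj₁ y≤m  = ∈-++⁺ˡ (Equivalence.from (sp y) (1≤y , ℕP.≤-pred y≤m))
  ... | inj₂ refl = ∈-++⁺ʳ p (here refl)

Spans-incr : ∀ k → Spans (incr k) k
Spans-incr k y = mk⇔ to from
  where
  to : y ∈ incr k → 1 ≤ℕ y × y ≤ℕ k
  to y∈ with ∈-map⁻ suc y∈
  ... | i , i∈ , refl = s≤s z≤n , ∈-upTo⁻ i∈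
  from : 1 ≤ℕ y × y ≤ℕ k → y ∈ incr k
  from (s≤s _ , y≤k) = ∈-map⁺ suc (∈-upTo⁺ y≤k)

distinctBelow-Spans : ∀ {p m} → Spans p m → ∀ x → x ≤ℕ suc m → distinctBelow p x ≡ x ∸ 1
distinctBelow-Spans sp zero    _         = refl
distinctBelow-Spans {p} {m} sp (suc x) (s≤s x≤m) = begin
  length (filter P (upTo (suc x)))                      ≡⟨ cong (length ∘ filter P) (LP.upTo-∷ʳ x) ⟨
  length (filter P (upTo x ++ [ x ]))                   ≡⟨ cong length (LP.filter-++ P (upTo x) [ x ]) ⟩
  length (filter P (upTo x) ++ filter P [ x ])          ≡⟨ LP.length-++ (filter P (upTo x)) ⟩
  length (filter P (upTo x)) +ℕ length (filter P [ x ]) ≡⟨ cong₂ _+ℕ_ (distinctBelow-Spans sp x (ℕP.m≤n⇒m≤1+n x≤m))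
                                                                      (lastLetter x x≤m) ⟩
  (x ∸ 1) +ℕ [ x ≥1]                                    ≡⟨ ∸1+[≥1] x ⟩
  x                                                     ∎
  where
  P = λ y → y ∈? p
  [_≥1] : ℕ → ℕ
  [ zero  ≥1] = 0
  [ suc _ ≥1] = 1
  lastLetter : ∀ x → x ≤ℕ m → length (filter P [ x ]) ≡ [ x ≥1]
  lastLetter zero    _   =
    cong length (LP.filter-reject P (λ 0∈p → ℕP.<⇒≱ (proj₁ (Equivalence.to (sp 0) 0∈p)) z≤n))
  lastLetter (suc x) x<m = cong length (LP.filter-accept P (Equivalence.from (sp (suc x)) (s≤s z≤n , x<m)))
  ∸1+[≥1] : ∀ x → (x ∸ 1) +ℕ [ x ≥1] ≡ x
  ∸1+[≥1] zero    = refl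
  ∸1+[≥1] (suc x) = ℕP.+-comm x 1

distinctBelow-≤ : ∀ s → 0 ∉ s → ∀ x → distinctBelow s x ≤ℕ x ∸ 1
distinctBelow-≤ s 0∉s zero    = z≤n
distinctBelow-≤ s 0∉s (suc x) =
  subst₂ _≤ℕ_ (cong length (sym (LP.filter-reject P 0∉s))) (LP.length-applyUpTo suc x)
         (LP.length-filter P (applyUpTo suc x))
  where P = λ y → y ∈? s

standardize-incr : ∀ k → standardize (incr k) ≡ incr k
standardize-incr k = LP.map-id-local (All.tabulate fixes)
  where
  fixes : ∀ {x} → x ∈ incr k → suc (distinctBelow (incr k) x) ≡ x
  fixes {x} x∈ with Equivalence.to (Spans-incr k x) x∈
  ... | s≤s z≤n , x≤k = cong suc (distinctBelow-Spans (Spans-incr k) x (ℕP.m≤n⇒m≤1+n x≤k))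

incr-bounds : ∀ {m x} → x ∈ incr m → 1 ≤ℕ x × x ≤ℕ m
incr-bounds {m} {x} = Equivalence.to (Spans-incr m x)

ext : ℕ → ℕ → ℕ → List (List ℕ)
ext-new : ℕ → ℕ → ℕ → List (List ℕ)
ext d m zero    = [ [] ]
ext d m (suc n) = cartesianProductWith _∷_ (incr m) (ext d m n) ++ ext-new d m n
ext-new zero    m n = []
ext-new (suc d) m n = map (suc m ∷_) (ext d (suc m) n)

ext-sound : ∀ d m n {w} → w ∈ ext d m n → RGFFrom m w × length w ≡ n × All (_≤ℕ m +ℕ d) w
ext-sound d m zero (here refl) = _ , refl , []
ext-sound d m (suc n) w∈ with ∈-++⁻ (cartesianProductWith _∷_ (incr m) (ext d m n)) w∈
... | inj₁ w∈old with ∈-cartesianProductWith⁻ _∷_ (incr m) (ext d m n) w∈old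
...   | x , w , x∈ , w∈ , refl with incr-bounds x∈ | ext-sound d m n w∈
...     | 1≤x , x≤m | rgf , len , bounded =
  (1≤x , ℕP.m≤n⇒m≤1+n x≤m , subst (λ t → RGFFrom t w) (sym (ℕP.m≥n⇒m⊔n≡m x≤m)) rgf)
  , cong suc len , ℕP.≤-trans x≤m (ℕP.m≤m+n m d) ∷ bounded
ext-sound (suc d) m (suc n) w∈ | inj₂ w∈new with ∈-map⁻ (suc m ∷_) w∈new
... | w , w∈ , refl with ext-sound d (suc m) n w∈
...   | rgf , len , bounded =
  (s≤s z≤n , ℕP.≤-refl , subst (λ t → RGFFrom t w) (sym (ℕP.m≤n⇒m⊔n≡n (ℕP.n≤1+n m))) rgf)
  , cong suc len
  , subst (λ b → All (_≤ℕ b) (suc m ∷ w)) (sym (ℕP.+-suc m d)) (s≤s (ℕP.m≤m+n m d) ∷ bounded)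

ext-complete : ∀ d m n w → RGFFrom m w → length w ≡ n → All (_≤ℕ m +ℕ d) w → w ∈ ext d m n
ext-complete d m zero [] _ _ _ = here refl
ext-complete d m (suc n) (x ∷ w) (1≤x , x≤1+m , rgf) len (x≤m+d ∷ bounded) with x ℕ.≤? m
... | yes x≤m = ∈-++⁺ˡ (∈-cartesianProductWith⁺ _∷_ (Equivalence.from (Spans-incr m x) (1≤x , x≤m))
                  (ext-complete d m n w (subst (λ t → RGFFrom t w) (ℕP.m≥n⇒m⊔n≡m x≤m) rgf)
                                (ℕP.suc-injective len) bounded))
... | no x≰m with ℕP.≤-antisym x≤1+m (ℕP.≰⇒> x≰m) | d
...   | refl | zero  = ⊥-elim (x≰m (subst (x ≤ℕ_) (ℕP.+-identityʳ m) x≤m+d))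
...   | refl | suc d = ∈-++⁺ʳ (cartesianProductWith _∷_ (incr m) (ext (suc d) m n))
                  (∈-map⁺ (suc m ∷_) (ext-complete d (suc m) n w
                     (subst (λ t → RGFFrom t w) (ℕP.m≤n⇒m⊔n≡n (ℕP.n≤1+n m)) rgf) (ℕP.suc-injective len)
                     (subst (λ b → All (_≤ℕ b) w) (ℕP.+-suc m d) bounded)))

incr-unique : ∀ m → Unique (incr m)
incr-unique m = UP.map⁺ ℕP.suc-injective (UP.upTo⁺ m)

ext-unique : ∀ d m n → Unique (ext d m n)
ext-unique d m zero    = [] ∷ []
ext-unique d m (suc n) =
  UP.++⁺ (UP.cartesianProductWith⁺ _∷_ LP.∷-injective (incr-unique m) (ext-unique d m n)) (new-unique d) disjoint
  where
  new-unique : ∀ d → Unique (ext-new d m n)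
  new-unique zero    = []
  new-unique (suc d) = UP.map⁺ LP.∷-injectiveʳ (ext-unique d (suc m) n)
  new-heads : ∀ d {v} → v ∈ ext-new d m n → ∃ λ w → v ≡ suc m ∷ w
  new-heads (suc d) v∈ with ∈-map⁻ (suc m ∷_) v∈
  ... | w , _ , v≡ = w , v≡
  disjoint : ∀ {v} → ¬ (v ∈ cartesianProductWith _∷_ (incr m) (ext d m n) × v ∈ ext-new d m n)
  disjoint (v∈old , v∈new) with ∈-cartesianProductWith⁻ _∷_ (incr m) (ext d m n) v∈old | new-heads d v∈new
  ... | x , _ , x∈ , _ , refl | _ , refl = ℕP.1+n≰n (proj₂ (incr-bounds x∈))

RGFFrom⇒positive : ∀ m w → RGFFrom m w → All (1 ≤ℕ_) w
RGFFrom⇒positive m []       _               = []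
RGFFrom⇒positive m (x ∷ xs) (1≤x , _ , rgf) = 1≤x ∷ RGFFrom⇒positive (m ℕ.⊔ x) xs rgf

-- An RGF reaches each new maximum one step at a time, so a letter ≥ a + l is preceded by a + 1, …, a + l.
iterate-⊆-RGF : ∀ m a l w → RGFFrom m w → m ≤ℕ a → Any (a +ℕ l ≤ℕ_) w → iterate suc (suc a) l ⊆ w
iterate-⊆-RGF m a zero w _ _ _ = minimum w
iterate-⊆-RGF m a (suc l) (y ∷ w) (_ , y≤1+m , rgf) m≤a large with y ℕ.≟ suc a
iterate-⊆-RGF m a (suc zero) (y ∷ w) _ m≤a large | yes refl = refl ∷ minimum w
iterate-⊆-RGF m a (suc (suc l)) (y ∷ w) _ m≤a (here a+l+2≤y) | yes refl =
  ⊥-elim (ℕP.m+1+n≰m (suc a) (subst (_≤ℕ suc a) (ℕP.+-suc a (suc l)) a+l+2≤y))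
iterate-⊆-RGF m a (suc (suc l)) (y ∷ w) (_ , _ , rgf) m≤a (there large) | yes refl =
  refl ∷ iterate-⊆-RGF (m ℕ.⊔ suc a) (suc a) (suc l) w rgf
           (ℕP.⊔-lub (ℕP.m≤n⇒m≤1+n m≤a) ℕP.≤-refl)
           (Any.map (λ {x} → subst (_≤ℕ x) (ℕP.+-suc a (suc l))) large)
iterate-⊆-RGF m a (suc l) (y ∷ w) (_ , y≤1+m , rgf) m≤a large | no y≢1+a =
  y ∷ʳ iterate-⊆-RGF (m ℕ.⊔ y) a (suc l) w rgf (ℕP.⊔-lub m≤a y≤a) (later large)
  where
  y≤a : y ≤ℕ a
  y≤a = ℕP.≤-pred (ℕP.≤∧≢⇒< (ℕP.≤-trans y≤1+m (s≤s m≤a)) y≢1+a)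
  later : Any (a +ℕ suc l ≤ℕ_) (y ∷ w) → Any (a +ℕ suc l ≤ℕ_) w
  later (here a+l+1≤y) = ⊥-elim (ℕP.m+1+n≰m a (ℕP.≤-trans a+l+1≤y y≤a))
  later (there p)      = p

incr≡iterate : ∀ k → incr k ≡ iterate suc 1 k
incr≡iterate k = trans (LP.map-upTo suc k) (applyUpTo≡iterate k suc (λ _ → refl))
  where
  applyUpTo≡iterate : ∀ n (f : ℕ → ℕ) → (∀ i → f (suc i) ≡ suc (f i)) →
    applyUpTo f n ≡ iterate suc (f 0) n
  applyUpTo≡iterate zero    f f-step = refl
  applyUpTo≡iterate (suc n) f f-step = cong (f 0 ∷_)
    (trans (applyUpTo≡iterate n (f ∘ suc) (f-step ∘ suc)) (cong (λ e → iterate suc e n) (f-step 0)))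

standardize-≤ : ∀ b s → All (1 ≤ℕ_) s → All (_≤ℕ b) s → All (_≤ℕ b) (standardize s)
standardize-≤ b s positive bounded = All-map⁺ (All.zipWith below (positive , bounded))
  where
  0∉s : 0 ∉ s
  0∉s 0∈s = ℕP.<⇒≱ (All.lookup positive 0∈s) z≤n
  below : ∀ {x} → 1 ≤ℕ x × x ≤ℕ b → suc (distinctBelow s x) ≤ℕ b
  below {suc x} (_ , x<b) = ℕP.≤-trans (s≤s (distinctBelow-≤ s 0∉s (suc x))) x<b

avoids-incr⇔bounded : ∀ b w → IsRGF w → Avoids w (incr (suc b)) ⇔ All (_≤ℕ b) w
avoids-incr⇔bounded b w rgf = mk⇔ to from
  where
  to : Avoids w (incr (suc b)) → All (_≤ℕ b) w
  to avoids with All.all? (ℕ._≤? b) w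
  ... | yes bounded = bounded
  ... | no unbounded = ⊥-elim (avoids (incr (suc b)
        , subst (_⊆ w) (sym (incr≡iterate (suc b))) (iterate-⊆-RGF 0 0 (suc b) w rgf z≤n large)
        , standardize-incr (suc b)))
    where large = Any.map ℕP.≰⇒> (¬All⇒Any¬ (ℕ._≤? b) w unbounded)
  from : All (_≤ℕ b) w → Avoids w (incr (suc b))
  from bounded (s , s⊆w , std≡incr) = ℕP.1+n≰n (All.lookup bounded-incr top∈incr)
    where
    positive = RGFFrom⇒positive 0 w rgf
    bounded-incr : All (_≤ℕ b) (incr (suc b))
    bounded-incr = subst (All (_≤ℕ b)) std≡incr
      (standardize-≤ b s (All-resp-⊆ s⊆w positive) (All-resp-⊆ s⊆w bounded))
    top∈incr : suc b ∈ incr (suc b)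
    top∈incr = Equivalence.from (Spans-incr (suc b) (suc b)) (s≤s z≤n , ℕP.≤-refl)

∈-ext⇔avoids-incr : ∀ b n w → w ∈ ext b 0 n ⇔ (IsRGF w × length w ≡ n × Avoids w (incr (suc b)))
∈-ext⇔avoids-incr b n w = mk⇔
  (λ w∈ext → let rgf , len , bounded = ext-sound b 0 n w∈ext in
     rgf , len , Equivalence.from (avoids-incr⇔bounded b w rgf) bounded)
  (λ (rgf , len , avoids) → ext-complete b 0 n w rgf len (Equivalence.to (avoids-incr⇔bounded b w rgf) avoids))

module _ (q : ℚ) where

  ^-distribˡ-+-* : ∀ a b → q ^ (a +ℕ b) ≡ q ^ a * q ^ b
  ^-distribˡ-+-* zero    b = sym (ℚP.*-identityˡ _)
  ^-distribˡ-+-* (suc a) b = trans (cong (q *_) (^-distribˡ-+-* a b)) (sym (ℚP.*-assoc q _ _))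

  qint-suc : ∀ m → qint q (suc m) ≡ 1ℚ + q * qint q m
  qint-suc m = cong (1ℚ +_) (sum-shift m (λ i → i))
    where
    sum-shift : ∀ m (f : ℕ → ℕ) →
      sumℚ (map (q ^_) (applyUpTo (λ i → suc (f i)) m)) ≡ q * sumℚ (map (q ^_) (applyUpTo f m))
    sum-shift zero    f = sym (ℚP.*-zeroʳ q)
    sum-shift (suc m) f = trans (cong (q * q ^ f 0 +_) (sum-shift m (λ i → f (suc i))))
                                (sym (ℚP.*-distribˡ-+ q _ _))

  qint-sucʳ : ∀ m → qint q (suc m) ≡ qint q m + q ^ m
  qint-sucʳ zero    = trans (qint-suc 0) (solve 1 (λ q → con 1ℚ :+ q :* con 0ℚ := con 0ℚ :+ con 1ℚ) refl q)
  qint-sucʳ (suc m) = begin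
    qint q (suc (suc m))             ≡⟨ qint-suc (suc m) ⟩
    1ℚ + q * qint q (suc m)          ≡⟨ cong (λ z → 1ℚ + q * z) (qint-sucʳ m) ⟩
    1ℚ + q * (qint q m + q ^ m)      ≡⟨ solve 3 (λ q a b → con 1ℚ :+ q :* (a :+ b) := (con 1ℚ :+ q :* a) :+ q :* b)
                                              refl q (qint q m) (q ^ m) ⟩
    (1ℚ + q * qint q m) + q * q ^ m  ≡⟨ cong (_+ q * q ^ m) (qint-suc m) ⟨
    qint q (suc m) + q ^ suc m       ∎

  qint≡Σ< : ∀ m → qint q m ≡ Σ< m (q ^_)
  qint≡Σ< zero    = refl
  qint≡Σ< (suc m) = trans (qint-sucʳ m) (cong (_+ q ^ m) (qint≡Σ< m))

  qint-+ : ∀ j t → qint q (j +ℕ t) ≡ qint q j + q ^ j * qint q t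
  qint-+ zero    t = solve 1 (λ a → a := con 0ℚ :+ con 1ℚ :* a) refl (qint q t)
  qint-+ (suc j) t = begin
    qint q (suc (j +ℕ t))                      ≡⟨ qint-suc (j +ℕ t) ⟩
    1ℚ + q * qint q (j +ℕ t)                   ≡⟨ cong (λ z → 1ℚ + q * z) (qint-+ j t) ⟩
    1ℚ + q * (qint q j + q ^ j * qint q t)     ≡⟨ solve 4 (λ q a b c → con 1ℚ :+ q :* (a :+ b :* c)
                                                                    := (con 1ℚ :+ q :* a) :+ (q :* b) :* c)
                                                          refl q (qint q j) (q ^ j) (qint q t) ⟩
    (1ℚ + q * qint q j) + q ^ suc j * qint q t ≡⟨ cong (_+ q ^ suc j * qint q t) (qint-suc j) ⟨
    qint q (suc j) + q ^ suc j * qint q t      ∎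

  G : ℕ → ℕ → ℕ → ℚ
  G-new : ℕ → ℕ → ℕ → ℚ
  G d m zero    = 1ℚ
  G d m (suc n) = qint q m * G d m n + G-new d m n
  G-new zero    m n = 0ℚ
  G-new (suc d) m n = q ^ m * G d (suc m) n

  weight : List ℕ → List ℕ → ℚ
  weight p w = q ^ lsFrom p w

  weight-∷ : ∀ {p m} → Spans p m → ∀ x w → x ≤ℕ suc m →
    weight p (x ∷ w) ≡ q ^ (x ∸ 1) * weight (p ++ [ x ]) w
  weight-∷ {p} sp x w x≤1+m =
    trans (cong (λ e → q ^ (e +ℕ lsFrom (p ++ [ x ]) w)) (distinctBelow-Spans sp x x≤1+m))
          (^-distribˡ-+-* (x ∸ 1) (lsFrom (p ++ [ x ]) w))

  sum-weight-ext : ∀ d m n {p} → Spans p m → sumℚ (map (weight p) (ext d m n)) ≡ G d m n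
  sum-weight-ext d m zero    sp = ℚP.+-identityʳ 1ℚ
  sum-weight-ext d m (suc n) {p} sp = begin
    sumℚ (map (weight p) (old ++ ext-new d m n))
      ≡⟨ cong sumℚ (LP.map-++ (weight p) old (ext-new d m n)) ⟩
    sumℚ (map (weight p) old ++ map (weight p) (ext-new d m n))
      ≡⟨ sumℚ-++ (map (weight p) old) _ ⟩
    sumℚ (map (weight p) old) + sumℚ (map (weight p) (ext-new d m n))
      ≡⟨ cong₂ _+_ sum-old (sum-new d) ⟩
    qint q m * G d m n + G-new d m n ∎
    where
    old = cartesianProductWith _∷_ (incr m) (ext d m n)
    sum-old : sumℚ (map (weight p) old) ≡ qint q m * G d m n
    sum-old = begin
      sumℚ (map (weight p) old)
        ≡⟨ sumℚ-cartesianProductWith (weight p) _∷_ (incr m) (ext d m n) ⟩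
      sumℚ (map (λ x → sumℚ (map (weight p ∘ (x ∷_)) (ext d m n))) (incr m))
        ≡⟨ sumℚ-map-cong (incr m) per-letter ⟩
      sumℚ (map ((_* G d m n) ∘ (q ^_) ∘ pred) (map suc (upTo m)))
        ≡⟨ cong sumℚ (LP.map-∘ (upTo m)) ⟨
      sumℚ (map (λ i → q ^ i * G d m n) (upTo m))
        ≡⟨ sumℚ-map-cong (upTo m) (λ _ → ℚP.*-comm _ (G d m n)) ⟩
      sumℚ (map (λ i → G d m n * q ^ i) (upTo m))
        ≡⟨ sumℚ-map-*ˡ (G d m n) (q ^_) (upTo m) ⟩
      G d m n * qint q m
        ≡⟨ ℚP.*-comm (G d m n) (qint q m) ⟩
      qint q m * G d m n ∎
      where
      per-letter : ∀ {x} → x ∈ incr m → sumℚ (map (weight p ∘ (x ∷_)) (ext d m n)) ≡ q ^ pred x * G d m n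
      per-letter {x} x∈ with incr-bounds x∈
      ... | 1≤x , x≤m = begin
        sumℚ (map (weight p ∘ (x ∷_)) (ext d m n))
          ≡⟨ sumℚ-map-cong (ext d m n) (λ {w} _ → weight-∷ sp x w (ℕP.m≤n⇒m≤1+n x≤m)) ⟩
        sumℚ (map (λ w → q ^ (x ∸ 1) * weight (p ++ [ x ]) w) (ext d m n))
          ≡⟨ sumℚ-map-*ˡ (q ^ (x ∸ 1)) (weight (p ++ [ x ])) (ext d m n) ⟩
        q ^ (x ∸ 1) * sumℚ (map (weight (p ++ [ x ])) (ext d m n))
          ≡⟨ cong (q ^ (x ∸ 1) *_) (sum-weight-ext d m n (Spans-∷ʳ-old sp 1≤x x≤m)) ⟩
        q ^ pred x * G d m n ∎
    sum-new : ∀ d → sumℚ (map (weight p) (ext-new d m n)) ≡ G-new d m n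
    sum-new zero    = refl
    sum-new (suc d) = begin
      sumℚ (map (weight p) (map (suc m ∷_) (ext d (suc m) n)))
        ≡⟨ cong sumℚ (LP.map-∘ (ext d (suc m) n)) ⟨
      sumℚ (map (weight p ∘ (suc m ∷_)) (ext d (suc m) n))
        ≡⟨ sumℚ-map-cong (ext d (suc m) n) (λ {w} _ → weight-∷ sp (suc m) w ℕP.≤-refl) ⟩
      sumℚ (map (λ w → q ^ m * weight (p ++ [ suc m ]) w) (ext d (suc m) n))
        ≡⟨ sumℚ-map-*ˡ (q ^ m) (weight (p ++ [ suc m ])) (ext d (suc m) n) ⟩
      q ^ m * sumℚ (map (weight (p ++ [ suc m ])) (ext d (suc m) n))
        ≡⟨ cong (q ^ m *_) (sum-weight-ext d (suc m) n (Spans-∷ʳ-new sp)) ⟩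
      q ^ m * G d (suc m) n ∎

  Σ<-G-new : ∀ d m n →
    Σ< d (λ r → q ^ suc (m +ℕ r) * G-new r m n)
      ≡ q ^ m * Σ< (pred d) (λ r → q ^ suc (suc m +ℕ r) * G r (suc m) n)
  Σ<-G-new zero     m n = sym (ℚP.*-zeroʳ (q ^ m))
  Σ<-G-new (suc d) m n = begin
    Σ< (suc d) (λ r → q ^ suc (m +ℕ r) * G-new r m n)
      ≡⟨ Σ<-head d _ ⟩
    q ^ suc (m +ℕ 0) * 0ℚ + Σ< d (λ r → q ^ suc (m +ℕ suc r) * (q ^ m * G r (suc m) n))
      ≡⟨ cong₂ _+_ (ℚP.*-zeroʳ (q ^ suc (m +ℕ 0))) (Σ<-cong d (λ r _ → reorder r)) ⟩
    0ℚ + Σ< d (λ r → q ^ m * (q ^ suc (suc m +ℕ r) * G r (suc m) n))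
      ≡⟨ ℚP.+-identityˡ _ ⟩
    Σ< d (λ r → q ^ m * (q ^ suc (suc m +ℕ r) * G r (suc m) n))
      ≡⟨ Σ<-*ˡ d (q ^ m) _ ⟩
    q ^ m * Σ< d (λ r → q ^ suc (suc m +ℕ r) * G r (suc m) n) ∎
    where
    reorder : ∀ r → q ^ suc (m +ℕ suc r) * (q ^ m * G r (suc m) n)
                  ≡ q ^ m * (q ^ suc (suc m +ℕ r) * G r (suc m) n)
    reorder r = trans (cong (λ e → q ^ suc e * (q ^ m * G r (suc m) n)) (ℕP.+-suc m r))
      (solve 3 (λ a b g → a :* (b :* g) := b :* (a :* g)) refl (q ^ suc (suc m +ℕ r)) (q ^ m) (G r (suc m) n))

  G-recurrence : ∀ d m n →
    G d m (suc n) ≡ qint q (m +ℕ d) * G d m n - Σ< (pred d) (λ r → q ^ suc (m +ℕ r) * G r m n)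
  G-recurrence zero m n =
    trans (solve 1 (λ x → x :+ con 0ℚ := x :- con 0ℚ) refl (qint q m * G 0 m n))
          (cong (λ e → qint q e * G 0 m n - 0ℚ) (sym (ℕP.+-identityʳ m)))
  G-recurrence (suc d) m zero = begin
    qint q m * 1ℚ + q ^ m * 1ℚ
      ≡⟨ solve 4 (λ a b c I → a :* con 1ℚ :+ b :* con 1ℚ
                               := (a :+ b :* (con 1ℚ :+ c :* I)) :* con 1ℚ :- c :* b :* I)
               refl (qint q m) (q ^ m) q (qint q d) ⟩
    (qint q m + q ^ m * (1ℚ + q * qint q d)) * 1ℚ - q ^ suc m * qint q d
      ≡⟨ cong₂ (λ a b → (qint q m + q ^ m * a) * 1ℚ - b) (sym (qint-suc d)) (sym powers) ⟩
    (qint q m + q ^ m * qint q (suc d)) * 1ℚ - Σ< d (λ r → q ^ suc (m +ℕ r) * 1ℚ)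
      ≡⟨ cong (λ a → a * 1ℚ - Σ< d (λ r → q ^ suc (m +ℕ r) * 1ℚ)) (qint-+ m (suc d)) ⟨
    qint q (m +ℕ suc d) * 1ℚ - Σ< d (λ r → q ^ suc (m +ℕ r) * 1ℚ) ∎
    where
    powers : Σ< d (λ r → q ^ suc (m +ℕ r) * 1ℚ) ≡ q ^ suc m * qint q d
    powers = begin
      Σ< d (λ r → q ^ suc (m +ℕ r) * 1ℚ)
        ≡⟨ Σ<-cong d (λ r _ → trans (ℚP.*-identityʳ _) (^-distribˡ-+-* (suc m) r)) ⟩
      Σ< d (λ r → q ^ suc m * q ^ r)    ≡⟨ Σ<-*ˡ d (q ^ suc m) (q ^_) ⟩
      q ^ suc m * Σ< d (q ^_)           ≡⟨ cong (q ^ suc m *_) (qint≡Σ< d) ⟨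
      q ^ suc m * qint q d              ∎
  G-recurrence (suc d) m (suc n) = begin
    qm * G (suc d) m (suc n) + q ^ m * G d (suc m) (suc n)
      ≡⟨ cong₂ (λ u v → qm * u + q ^ m * v) (G-recurrence (suc d) m n) (G-recurrence d (suc m) n) ⟩
    qm * (qb * T₁ - S₁) + q ^ m * (qint q (suc m +ℕ d) * T₂ - S₂)
      ≡⟨ cong (λ e → qm * (qb * T₁ - S₁) + q ^ m * (qint q e * T₂ - S₂)) (sym (ℕP.+-suc m d)) ⟩
    qm * (qb * T₁ - S₁) + q ^ m * (qb * T₂ - S₂)
      ≡⟨ solve 7 (λ a b c t₁ t₂ s₁ s₂ → a :* (b :* t₁ :- s₁) :+ c :* (b :* t₂ :- s₂)
                                       := b :* (a :* t₁ :+ c :* t₂) :- (a :* s₁ :+ c :* s₂))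
               refl qm qb (q ^ m) T₁ T₂ S₁ S₂ ⟩
    qb * (qm * T₁ + q ^ m * T₂) - (qm * S₁ + q ^ m * S₂)
      ≡⟨ cong (λ s → qb * G (suc d) m (suc n) - s) (sym sums) ⟩
    qb * G (suc d) m (suc n) - Σ< d (λ r → q ^ suc (m +ℕ r) * G r m (suc n)) ∎
    where
    qm = qint q m
    qb = qint q (m +ℕ suc d)
    T₁ = G (suc d) m n
    T₂ = G d (suc m) n
    S₁ = Σ< d (λ r → q ^ suc (m +ℕ r) * G r m n)
    S₂ = Σ< (pred d) (λ r → q ^ suc (suc m +ℕ r) * G r (suc m) n)
    sums : Σ< d (λ r → q ^ suc (m +ℕ r) * G r m (suc n)) ≡ qm * S₁ + q ^ m * S₂
    sums = begin
      Σ< d (λ r → q ^ suc (m +ℕ r) * G r m (suc n))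
        ≡⟨ Σ<-cong d (λ r _ → solve 4 (λ p a t u → p :* (a :* t :+ u) := a :* (p :* t) :+ p :* u)
                                       refl (q ^ suc (m +ℕ r)) qm (G r m n) (G-new r m n)) ⟩
      Σ< d (λ r → qm * (q ^ suc (m +ℕ r) * G r m n) + q ^ suc (m +ℕ r) * G-new r m n)
        ≡⟨ Σ<-+ d _ _ ⟩
      Σ< d (λ r → qm * (q ^ suc (m +ℕ r) * G r m n)) + Σ< d (λ r → q ^ suc (m +ℕ r) * G-new r m n)
        ≡⟨ cong₂ _+_ (Σ<-*ˡ d qm _) (Σ<-G-new d m n) ⟩
      qm * S₁ + q ^ m * S₂ ∎

  invFact : ℕ → ℚ
  invFact j = inv (qfact q j)

  cFuel-irrelevant : ∀ {g g′} t → 1 ≤ℕ t → t ≤ℕ g → t ≤ℕ g′ → cFuel q g t ≡ cFuel q g′ t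
  cFuel-irrelevant {zero}  (suc t) _ () _
  cFuel-irrelevant {suc g} {zero}   (suc t) _ _ ()
  cFuel-irrelevant {suc g} {suc g′} t 1≤t t≤1+g t≤1+g′ = cong (1ℚ -_) (begin
    Σ₁ (t ∸ 3) (λ j → cFuel q g (t ∸ j) * inv (qfact q j))
      ≡⟨ Σ₁≡Σ< (t ∸ 3) _ ⟩
    Σ< (t ∸ 3) (λ i → cFuel q g (t ∸ suc i) * inv (qfact q (suc i)))
      ≡⟨ Σ<-cong (t ∸ 3) (λ i i<t∸3 → cong (_* inv (qfact q (suc i)))
           (cFuel-irrelevant (t ∸ suc i) (ℕP.m<n⇒0<n∸m (suc<t {t} i i<t∸3))
                             (below t≤1+g) (below t≤1+g′))) ⟩
    Σ< (t ∸ 3) (λ i → cFuel q g′ (t ∸ suc i) * inv (qfact q (suc i)))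
      ≡⟨ Σ₁≡Σ< (t ∸ 3) _ ⟨
    Σ₁ (t ∸ 3) (λ j → cFuel q g′ (t ∸ j) * inv (qfact q j)) ∎)
    where
    suc<t : ∀ {t} i → i <ℕ t ∸ 3 → suc i <ℕ t
    suc<t {suc (suc (suc t))} i i<t = s≤s (s≤s (ℕP.m≤n⇒m≤1+n (ℕP.<⇒≤ i<t)))
    below : ∀ {i g} → t ≤ℕ suc g → t ∸ suc i ≤ℕ g
    below {i} {g} t≤1+g = ℕP.≤-trans (ℕP.∸-monoˡ-≤ (suc i) t≤1+g) (ℕP.m∸n≤m g i)

  c⁺ : ℕ → ℚ
  c⁺ s = c q (3 +ℕ s)

  c⁺-rec : ∀ s → c⁺ s ≡ 1ℚ - Σ< s (λ i → c⁺ (s ∸ suc i) * invFact (suc i))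
  c⁺-rec s = cong (1ℚ -_) (trans (Σ₁≡Σ< s _) (Σ<-cong s term))
    where
    term : ∀ i → i <ℕ s →
      cFuel q (2 +ℕ s) (2 +ℕ s ∸ i) * invFact (suc i) ≡ c⁺ (s ∸ suc i) * invFact (suc i)
    term i i<s = cong (_* invFact (suc i)) (begin
      cFuel q (2 +ℕ s) (2 +ℕ s ∸ i)       ≡⟨ cong (cFuel q (2 +ℕ s)) (ℕP.+-∸-assoc 3 i<s) ⟩
      cFuel q (2 +ℕ s) (3 +ℕ (s ∸ suc i))
        ≡⟨ cFuel-irrelevant (3 +ℕ (s ∸ suc i)) (s≤s z≤n) (s≤s (s≤s fuel)) ℕP.≤-refl ⟩
      c⁺ (s ∸ suc i)                       ∎)
      where
      fuel : suc (s ∸ suc i) ≤ℕ s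
      fuel = ℕP.≤-trans (ℕP.≤-reflexive (sym (ℕP.+-∸-assoc 1 i<s))) (ℕP.m∸n≤m s i)

  invFact⋆c⁺≡1 : ∀ s → (invFact ⋆ c⁺) s ≡ 1ℚ
  invFact⋆c⁺≡1 s = begin
    (invFact ⋆ c⁺) s                                       ≡⟨ Σ<-head s _ ⟩
    1ℚ * c⁺ s + S                                          ≡⟨ cong (λ x → 1ℚ * x + S) (c⁺-rec s) ⟩
    1ℚ * (1ℚ - Σ< s (λ i → c⁺ (s ∸ suc i) * invFact (suc i))) + S
      ≡⟨ cong (λ x → 1ℚ * (1ℚ - x) + S)
              (Σ<-cong s (λ i _ → ℚP.*-comm (c⁺ (s ∸ suc i)) (invFact (suc i)))) ⟩
    1ℚ * (1ℚ - S) + S                                      ≡⟨ solve 1 (λ a → con 1ℚ :* (con 1ℚ :- a) :+ a := con 1ℚ) refl S ⟩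
    1ℚ                                                     ∎
    where S = Σ< s (λ i → invFact (suc i) * c⁺ (s ∸ suc i))

  cSum : ℕ → (ℕ → ℚ) → ℚ
  cSum p κ = Σ< p (λ i → invFact i * c⁺ (p ∸ suc i) * κ i)

  cCross : ℕ → (ℕ → ℚ) → ℚ
  cCross p κ = Σ< p (λ i → invFact i * κ i * q ^ suc (suc i) * (qint q (p ∸ suc i) * c⁺ (p ∸ suc i)))

  K⁺ : ℕ → ℕ → ℚ
  K⁺ n i = K q (suc i) n

  closedForm : ℕ → ℕ → ℚ
  closedForm p n = 1ℚ + cSum p (K⁺ n)

  RHS≡closedForm : ∀ p n → RHS q (suc (suc p)) n ≡ closedForm p n
  RHS≡closedForm p n = cong (1ℚ +_) (trans (Σ₁≡Σ< p _) (Σ<-cong p (λ i i<p →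
    cong (λ t → invFact i * c q (suc t) * K q (suc i) n) (ℕP.+-∸-assoc 2 i<p))))

  cSum-+ : ∀ p κ a → cSum (suc p) (λ i → κ i + a) ≡ cSum (suc p) κ + a
  cSum-+ p κ a = begin
    Σ< (suc p) (λ i → α i * (κ i + a))     ≡⟨ Σ<-cong (suc p) (λ i _ → ℚP.*-distribˡ-+ (α i) (κ i) a) ⟩
    Σ< (suc p) (λ i → α i * κ i + α i * a) ≡⟨ Σ<-+ (suc p) _ _ ⟩
    cSum (suc p) κ + Σ< (suc p) (λ i → α i * a)
      ≡⟨ cong (cSum (suc p) κ +_) (Σ<-cong (suc p) (λ i _ → ℚP.*-comm (α i) a)) ⟩
    cSum (suc p) κ + Σ< (suc p) (λ i → a * α i) ≡⟨ cong (cSum (suc p) κ +_) (Σ<-*ˡ (suc p) a α) ⟩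
    cSum (suc p) κ + a * (invFact ⋆ c⁺) p   ≡⟨ cong (λ x → cSum (suc p) κ + a * x) (invFact⋆c⁺≡1 p) ⟩
    cSum (suc p) κ + a * 1ℚ                 ≡⟨ cong (cSum (suc p) κ +_) (ℚP.*-identityʳ a) ⟩
    cSum (suc p) κ + a                      ∎
    where
    α : ℕ → ℚ
    α i = invFact i * c⁺ (p ∸ i)

  qint-*-cSum : ∀ p κ → qint q (suc p) * cSum p κ ≡ cSum p (λ i → qint q (suc (suc i)) * κ i) + cCross p κ
  qint-*-cSum p κ = begin
    qint q (suc p) * cSum p κ
      ≡⟨ Σ<-*ˡ p (qint q (suc p)) _ ⟨
    Σ< p (λ i → qint q (suc p) * (invFact i * c⁺ (p ∸ suc i) * κ i))
      ≡⟨ Σ<-cong p split ⟩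
    Σ< p (λ i → invFact i * c⁺ (p ∸ suc i) * (qint q (suc (suc i)) * κ i)
              + invFact i * κ i * q ^ suc (suc i) * (qint q (p ∸ suc i) * c⁺ (p ∸ suc i)))
      ≡⟨ Σ<-+ p _ _ ⟩
    cSum p (λ i → qint q (suc (suc i)) * κ i) + cCross p κ ∎
    where
    split : ∀ i → i <ℕ p → qint q (suc p) * (invFact i * c⁺ (p ∸ suc i) * κ i)
      ≡ invFact i * c⁺ (p ∸ suc i) * (qint q (suc (suc i)) * κ i)
        + invFact i * κ i * q ^ suc (suc i) * (qint q (p ∸ suc i) * c⁺ (p ∸ suc i))
    split i i<p = begin
      qint q (suc p) * (invFact i * c⁺ (p ∸ suc i) * κ i)
        ≡⟨ cong (λ t → qint q (suc t) * (invFact i * c⁺ (p ∸ suc i) * κ i)) (ℕP.m+[n∸m]≡n i<p) ⟨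
      qint q (suc (suc i) +ℕ (p ∸ suc i)) * (invFact i * c⁺ (p ∸ suc i) * κ i)
        ≡⟨ cong (_* (invFact i * c⁺ (p ∸ suc i) * κ i)) (qint-+ (suc (suc i)) (p ∸ suc i)) ⟩
      (qint q (suc (suc i)) + q ^ suc (suc i) * qint q (p ∸ suc i)) * (invFact i * c⁺ (p ∸ suc i) * κ i)
        ≡⟨ solve 6 (λ a b c f d k → (a :+ b :* c) :* (f :* d :* k)
                                   := f :* d :* (a :* k) :+ f :* k :* b :* (c :* d))
                 refl (qint q (suc (suc i))) (q ^ suc (suc i)) (qint q (p ∸ suc i))
                      (invFact i) (c⁺ (p ∸ suc i)) (κ i) ⟩
      invFact i * c⁺ (p ∸ suc i) * (qint q (suc (suc i)) * κ i)
        + invFact i * κ i * q ^ suc (suc i) * (qint q (p ∸ suc i) * c⁺ (p ∸ suc i)) ∎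

  module _ (q≥0 : 0ℚ ≤ℚ q) where

    qint-suc-positive : ∀ m → Positive (qint q (suc m))
    qint-nonNegative : ∀ m → NonNegative (qint q m)
    qint-nonNegative zero    = _
    qint-nonNegative (suc m) = ℚP.pos⇒nonNeg (qint q (suc m)) {{qint-suc-positive m}}
    qint-suc-positive m = subst Positive (sym (qint-suc m))
      (ℚP.pos+nonNeg⇒pos 1ℚ (q * qint q m)
        {{ℚP.nonNeg*nonNeg⇒nonNeg q {{ℚ.nonNegative q≥0}} (qint q m) {{qint-nonNegative m}}}})

    qfact-positive : ∀ m → Positive (qfact q m)
    qfact-positive zero    = _
    qfact-positive (suc m) =
      ℚP.pos*pos⇒pos (qfact q m) {{qfact-positive m}} (qint q (suc m)) {{qint-suc-positive m}}

    qint-*-invFact-suc : ∀ j → qint q (suc j) * invFact (suc j) ≡ invFact j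
    qint-*-invFact-suc j = *-inv-cancelˡ (qfact q j) (qint q (suc j))
      (positive⇒≢0 _ (qfact-positive j)) (positive⇒≢0 _ (qfact-positive (suc j)))

    qinvFact : ℕ → ℚ
    qinvFact j = q ^ j * invFact j

    powerTail : ℕ → ℚ
    powerTail s = Σ< (pred s) (λ r → q ^ suc r)

    qinvFact⋆qint-c⁺ : ∀ s → (qinvFact ⋆ (λ t → qint q t * c⁺ t)) s ≡ powerTail s
    qinvFact⋆qint-c⁺ zero =
      solve 2 (λ a b → con 0ℚ :+ a :* (con 0ℚ :* b) := con 0ℚ) refl (qinvFact 0) (c⁺ 0)
    qinvFact⋆qint-c⁺ (suc N) = begin
      conv                          ≡⟨ solve 2 (λ x y → y := (x :+ y) :- x) refl X conv ⟩
      (X + conv) - X                ≡⟨ cong₂ _-_ (sym qint≡X+conv) X≡1 ⟩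
      qint q (suc N) - 1ℚ           ≡⟨ cong (_- 1ℚ) (qint-suc N) ⟩
      (1ℚ + q * qint q N) - 1ℚ      ≡⟨ solve 2 (λ q a → (con 1ℚ :+ q :* a) :- con 1ℚ := q :* a) refl q (qint q N) ⟩
      q * qint q N                  ≡⟨ cong (q *_) (qint≡Σ< N) ⟩
      q * Σ< N (q ^_)               ≡⟨ Σ<-*ˡ N q (q ^_) ⟨
      powerTail (suc N)             ∎
      where
      conv = (qinvFact ⋆ (λ t → qint q t * c⁺ t)) (suc N)
      X = Σ< (suc (suc N)) (λ j → qint q j * (invFact j * c⁺ (suc N ∸ j)))
      split : ∀ j → j <ℕ suc (suc N) → qint q (suc N) * (invFact j * c⁺ (suc N ∸ j))
        ≡ qint q j * (invFact j * c⁺ (suc N ∸ j)) + qinvFact j * (qint q (suc N ∸ j) * c⁺ (suc N ∸ j))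
      split j j≤1+N = begin
        qint q (suc N) * (invFact j * c⁺ (suc N ∸ j))
          ≡⟨ cong (λ t → qint q t * (invFact j * c⁺ (suc N ∸ j))) (ℕP.m+[n∸m]≡n (ℕP.≤-pred j≤1+N)) ⟨
        qint q (j +ℕ (suc N ∸ j)) * (invFact j * c⁺ (suc N ∸ j))
          ≡⟨ cong (_* (invFact j * c⁺ (suc N ∸ j))) (qint-+ j (suc N ∸ j)) ⟩
        (qint q j + q ^ j * qint q (suc N ∸ j)) * (invFact j * c⁺ (suc N ∸ j))
          ≡⟨ solve 5 (λ a b c d e → (a :+ b :* c) :* (d :* e) := a :* (d :* e) :+ (b :* d) :* (c :* e))
                   refl (qint q j) (q ^ j) (qint q (suc N ∸ j)) (invFact j) (c⁺ (suc N ∸ j)) ⟩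
        qint q j * (invFact j * c⁺ (suc N ∸ j)) + qinvFact j * (qint q (suc N ∸ j) * c⁺ (suc N ∸ j)) ∎
      qint≡X+conv : qint q (suc N) ≡ X + conv
      qint≡X+conv = begin
        qint q (suc N)                          ≡⟨ ℚP.*-identityʳ (qint q (suc N)) ⟨
        qint q (suc N) * 1ℚ                     ≡⟨ cong (qint q (suc N) *_) (invFact⋆c⁺≡1 (suc N)) ⟨
        qint q (suc N) * (invFact ⋆ c⁺) (suc N) ≡⟨ Σ<-*ˡ (suc (suc N)) (qint q (suc N)) _ ⟨
        Σ< (suc (suc N)) (λ j → qint q (suc N) * (invFact j * c⁺ (suc N ∸ j)))
          ≡⟨ trans (Σ<-cong (suc (suc N)) split) (Σ<-+ (suc (suc N)) _ _) ⟩
        X + conv                                ∎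
      X≡1 : X ≡ 1ℚ
      X≡1 = begin
        X ≡⟨ Σ<-head (suc N) _ ⟩
        0ℚ * (invFact 0 * c⁺ (suc N)) + Σ< (suc N) (λ i → qint q (suc i) * (invFact (suc i) * c⁺ (N ∸ i)))
          ≡⟨ cong₂ _+_ (ℚP.*-zeroˡ (invFact 0 * c⁺ (suc N))) (Σ<-cong (suc N) (λ i _ →
               trans (sym (ℚP.*-assoc (qint q (suc i)) _ _)) (cong (_* c⁺ (N ∸ i)) (qint-*-invFact-suc i)))) ⟩
        0ℚ + (invFact ⋆ c⁺) N ≡⟨ ℚP.+-identityˡ _ ⟩
        (invFact ⋆ c⁺) N      ≡⟨ invFact⋆c⁺≡1 N ⟩
        1ℚ                    ∎

    qinvFact⋆c⁺-tail : ∀ s →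
      (qinvFact ⋆ (λ t → Σ< (pred t) (λ u → q ^ suc u * c⁺ u))) s ≡ powerTail s
    qinvFact⋆c⁺-tail zero = solve 1 (λ a → con 0ℚ :+ a :* con 0ℚ := con 0ℚ) refl (qinvFact 0)
    qinvFact⋆c⁺-tail (suc N) = begin
      (Σ< N F + F N) + F (suc N)
        ≡⟨ cong₂ _+_ (cong₂ _+_ main (cong (λ t → qinvFact N * Z t) (ℕP.+-∸-assoc 1 (ℕP.≤-refl {N}))))
                     (cong (λ t → qinvFact (suc N) * Z t) (ℕP.n∸n≡0 N)) ⟩
      (powerTail (suc N) + qinvFact N * Z (suc (N ∸ N))) + qinvFact (suc N) * 0ℚ
        ≡⟨ cong (λ t → (powerTail (suc N) + qinvFact N * Z (suc t)) + qinvFact (suc N) * 0ℚ) (ℕP.n∸n≡0 N) ⟩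
      (powerTail (suc N) + qinvFact N * 0ℚ) + qinvFact (suc N) * 0ℚ
        ≡⟨ solve 3 (λ h a b → (h :+ a :* con 0ℚ) :+ b :* con 0ℚ := h)
                 refl (powerTail (suc N)) (qinvFact N) (qinvFact (suc N)) ⟩
      powerTail (suc N) ∎
      where
      Z : ℕ → ℚ
      Z t = Σ< (pred t) (λ u → q ^ suc u * c⁺ u)
      F : ℕ → ℚ
      F j = qinvFact j * Z (suc N ∸ j)
      regroup : ∀ r j → j <ℕ suc r →
        qinvFact j * (q ^ suc (r ∸ j) * c⁺ (r ∸ j)) ≡ q ^ suc r * (invFact j * c⁺ (r ∸ j))
      regroup r j j≤r = begin
        qinvFact j * (q ^ suc (r ∸ j) * c⁺ (r ∸ j))
          ≡⟨ solve 4 (λ a b c d → (a :* b) :* (c :* d) := (a :* c) :* (b :* d))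
                   refl (q ^ j) (invFact j) (q ^ suc (r ∸ j)) (c⁺ (r ∸ j)) ⟩
        (q ^ j * q ^ suc (r ∸ j)) * (invFact j * c⁺ (r ∸ j))
          ≡⟨ cong (_* (invFact j * c⁺ (r ∸ j))) (^-distribˡ-+-* j (suc (r ∸ j))) ⟨
        q ^ (j +ℕ suc (r ∸ j)) * (invFact j * c⁺ (r ∸ j))
          ≡⟨ cong (λ t → q ^ t * (invFact j * c⁺ (r ∸ j)))
                  (trans (ℕP.+-suc j (r ∸ j)) (cong suc (ℕP.m+[n∸m]≡n (ℕP.≤-pred j≤r)))) ⟩
        q ^ suc r * (invFact j * c⁺ (r ∸ j)) ∎
      antidiagonal : ∀ r → Σ< (suc r) (λ j → qinvFact j * (q ^ suc (r ∸ j) * c⁺ (r ∸ j))) ≡ q ^ suc r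
      antidiagonal r = begin
        Σ< (suc r) (λ j → qinvFact j * (q ^ suc (r ∸ j) * c⁺ (r ∸ j))) ≡⟨ Σ<-cong (suc r) (regroup r) ⟩
        Σ< (suc r) (λ j → q ^ suc r * (invFact j * c⁺ (r ∸ j)))       ≡⟨ Σ<-*ˡ (suc r) (q ^ suc r) _ ⟩
        q ^ suc r * (invFact ⋆ c⁺) r                                   ≡⟨ cong (q ^ suc r *_) (invFact⋆c⁺≡1 r) ⟩
        q ^ suc r * 1ℚ                                                 ≡⟨ ℚP.*-identityʳ (q ^ suc r) ⟩
        q ^ suc r                                                      ∎
      main : Σ< N F ≡ powerTail (suc N)
      main = begin
        Σ< N F
          ≡⟨ Σ<-cong N (λ j j<N → cong (λ t → qinvFact j * Z t) (ℕP.+-∸-assoc 1 (ℕP.<⇒≤ j<N))) ⟩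
        Σ< N (λ j → qinvFact j * Σ< (N ∸ j) (λ u → q ^ suc u * c⁺ u))
          ≡⟨ Σ<-cong N (λ j _ → sym (Σ<-*ˡ (N ∸ j) (qinvFact j) _)) ⟩
        Σ< N (λ j → Σ< (N ∸ j) (λ u → qinvFact j * (q ^ suc u * c⁺ u)))
          ≡⟨ Σ<-triangle-antidiagonals N (λ j u → qinvFact j * (q ^ suc u * c⁺ u)) ⟩
        Σ< N (λ r → Σ< (suc r) (λ j → qinvFact j * (q ^ suc (r ∸ j) * c⁺ (r ∸ j))))
          ≡⟨ Σ<-cong N (λ r _ → antidiagonal r) ⟩
        powerTail (suc N) ∎

    -- The coefficient-wise form of the q-difference equation satisfied by Σ c_{s+3} x^s.
    qint-*-c⁺ : ∀ s → qint q s * c⁺ s ≡ Σ< (pred s) (λ u → q ^ suc u * c⁺ u)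
    qint-*-c⁺ = ⋆-cancelˡ qinvFact _ _ refl (λ s → trans (qinvFact⋆qint-c⁺ s) (sym (qinvFact⋆c⁺-tail s)))

    Σ<-q^-*-cSum : ∀ P κ → Σ< P (λ a → q ^ suc (suc a) * cSum a κ) ≡ cCross (suc P) κ
    Σ<-q^-*-cSum P κ = begin
      Σ< P (λ a → q ^ suc (suc a) * cSum a κ)
        ≡⟨ Σ<-cong P (λ a _ → sym (Σ<-*ˡ a (q ^ suc (suc a)) _)) ⟩
      Σ< P (λ a → Σ< a (λ i → q ^ suc (suc a) * (invFact i * c⁺ (a ∸ suc i) * κ i)))
        ≡⟨ Σ<-triangle-swap P (λ a i → q ^ suc (suc a) * (invFact i * c⁺ (a ∸ suc i) * κ i)) ⟩
      Σ< P (λ i → Σ< (P ∸ suc i) (λ r →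
        q ^ suc (suc (suc (i +ℕ r))) * (invFact i * c⁺ (suc (i +ℕ r) ∸ suc i) * κ i)))
        ≡⟨ Σ<-cong P (λ i _ → trans (Σ<-cong (P ∸ suc i) (λ r _ → regroup i r))
                                    (Σ<-*ˡ (P ∸ suc i) (β i) _)) ⟩
      Σ< P (λ i → β i * Σ< (P ∸ suc i) (λ r → q ^ suc r * c⁺ r))
        ≡⟨ Σ<-cong P (λ i _ → cong (λ t → β i * Σ< t (λ r → q ^ suc r * c⁺ r))
                                   (sym (ℕP.pred[m∸n]≡m∸[1+n] P i))) ⟩
      Σ< P (λ i → β i * Σ< (pred (P ∸ i)) (λ r → q ^ suc r * c⁺ r))
        ≡⟨ Σ<-cong P (λ i _ → cong (β i *_) (sym (qint-*-c⁺ (P ∸ i)))) ⟩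
      Σ< P γ         ≡⟨ ℚP.+-identityʳ (Σ< P γ) ⟨
      Σ< P γ + 0ℚ    ≡⟨ cong (Σ< P γ +_) γP≡0 ⟨
      Σ< P γ + γ P   ∎
      where
      β : ℕ → ℚ
      β i = invFact i * κ i * q ^ suc (suc i)
      γ : ℕ → ℚ
      γ i = β i * (qint q (P ∸ i) * c⁺ (P ∸ i))
      regroup : ∀ i r → q ^ suc (suc (suc (i +ℕ r))) * (invFact i * c⁺ (suc (i +ℕ r) ∸ suc i) * κ i)
                      ≡ β i * (q ^ suc r * c⁺ r)
      regroup i r = begin
        q ^ suc (suc (suc (i +ℕ r))) * (invFact i * c⁺ (i +ℕ r ∸ i) * κ i)
          ≡⟨ cong₂ (λ t u → q ^ t * (invFact i * c⁺ u * κ i))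
                   (cong (suc ∘ suc) (sym (ℕP.+-suc i r))) (ℕP.m+n∸m≡n i r) ⟩
        q ^ (suc (suc i) +ℕ suc r) * (invFact i * c⁺ r * κ i)
          ≡⟨ cong (_* (invFact i * c⁺ r * κ i)) (^-distribˡ-+-* (suc (suc i)) (suc r)) ⟩
        (q ^ suc (suc i) * q ^ suc r) * (invFact i * c⁺ r * κ i)
          ≡⟨ solve 5 (λ a b f d k → (a :* b) :* (f :* d :* k) := (f :* k :* a) :* (b :* d))
                   refl (q ^ suc (suc i)) (q ^ suc r) (invFact i) (c⁺ r) (κ i) ⟩
        β i * (q ^ suc r * c⁺ r) ∎
      γP≡0 : γ P ≡ 0ℚ
      γP≡0 = trans (cong (λ t → β P * (qint q t * c⁺ t)) (ℕP.n∸n≡0 P))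
                   (solve 2 (λ a d → a :* (con 0ℚ :* d) := con 0ℚ) refl (β P) (c⁺ 0))

    K-suc : ∀ m n → K q (suc m) (suc (suc n)) ≡ qint q (suc (suc m)) * K q (suc m) (suc n) + q
    K-suc m n = begin
      (B * x - 1ℚ) * z
        ≡⟨ solve 3 (λ b x z → (b :* x :- con 1ℚ) :* z := b :* ((x :- con 1ℚ) :* z) :+ (b :- con 1ℚ) :* z)
                 refl B x z ⟩
      B * ((x - 1ℚ) * z) + (B - 1ℚ) * z
        ≡⟨ cong (λ t → B * ((x - 1ℚ) * z) + (t - 1ℚ) * z) (qint-suc (suc m)) ⟩
      B * ((x - 1ℚ) * z) + ((1ℚ + q * y) - 1ℚ) * z
        ≡⟨ cong (B * ((x - 1ℚ) * z) +_)
                (solve 3 (λ q y z → ((con 1ℚ :+ q :* y) :- con 1ℚ) :* z := q :* (y :* z)) refl q y z) ⟩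
      B * ((x - 1ℚ) * z) + q * (y * z)
        ≡⟨ cong (λ t → B * ((x - 1ℚ) * z) + q * t) (inv-inverseʳ y (positive⇒≢0 y (qint-suc-positive m))) ⟩
      B * ((x - 1ℚ) * z) + q * 1ℚ
        ≡⟨ cong (B * ((x - 1ℚ) * z) +_) (ℚP.*-identityʳ q) ⟩
      B * ((x - 1ℚ) * z) + q ∎
      where
      B = qint q (suc (suc m))
      y = qint q (suc m)
      x = B ^ n
      z = inv y

    K-1 : ∀ m → K q m 1 ≡ 0ℚ
    K-1 m = ℚP.*-zeroˡ (inv (qint q m))

    closedForm-recurrence : ∀ p n → closedForm p (suc (suc n)) ≡
      qint q (suc p) * closedForm p (suc n) - Σ< (pred p) (λ a → q ^ suc (suc a) * closedForm a (suc n))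
    closedForm-recurrence zero n = begin
      1ℚ + 0ℚ                         ≡⟨ solve 1 (λ q → con 1ℚ :+ con 0ℚ
                                                   := (con 1ℚ :+ q :* con 0ℚ) :* (con 1ℚ :+ con 0ℚ) :- con 0ℚ) refl q ⟩
      (1ℚ + q * 0ℚ) * (1ℚ + 0ℚ) - 0ℚ ≡⟨ cong (λ t → t * (1ℚ + 0ℚ) - 0ℚ) (qint-suc 0) ⟨
      qint q 1 * (1ℚ + 0ℚ) - 0ℚ     ∎
    closedForm-recurrence (suc P) n = begin
      1ℚ + cSum (suc P) (K⁺ (suc (suc n)))
        ≡⟨ cong (1ℚ +_) (trans (Σ<-cong (suc P) (λ i _ → cong (invFact i * c⁺ (P ∸ i) *_) (K-suc i n)))
                               (cSum-+ P A q)) ⟩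
      1ℚ + (cSum (suc P) A + q)
        ≡⟨ solve 4 (λ q I a c → con 1ℚ :+ (a :+ q)
                               := ((con 1ℚ :+ q :* (con 1ℚ :+ q :* I)) :+ (a :+ c)) :- (q :* (q :* I) :+ c))
                 refl q (qint q P) (cSum (suc P) A) C ⟩
      ((1ℚ + q * (1ℚ + q * qint q P)) + (cSum (suc P) A + C)) - (q * (q * qint q P) + C)
        ≡⟨ cong₂ (λ u v → (u + v) - (q * (q * qint q P) + C)) (sym [P+2]) (sym (qint-*-cSum (suc P) κ)) ⟩
      (qint q (suc (suc P)) + qint q (suc (suc P)) * W) - (q * (q * qint q P) + C)
        ≡⟨ cong₂ _-_ (solve 2 (λ b w → b :+ b :* w := b :* (con 1ℚ :+ w)) refl (qint q (suc (suc P))) W)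
                     (sym earlier) ⟩
      qint q (suc (suc P)) * (1ℚ + W) - Σ< P (λ a → q ^ suc (suc a) * closedForm a (suc n)) ∎
      where
      κ = K⁺ (suc n)
      A : ℕ → ℚ
      A i = qint q (suc (suc i)) * κ i
      W = cSum (suc P) κ
      C = cCross (suc P) κ
      [P+2] : qint q (suc (suc P)) ≡ 1ℚ + q * (1ℚ + q * qint q P)
      [P+2] = trans (qint-suc (suc P)) (cong (λ t → 1ℚ + q * t) (qint-suc P))
      earlier : Σ< P (λ a → q ^ suc (suc a) * closedForm a (suc n)) ≡ q * (q * qint q P) + C
      earlier = begin
        Σ< P (λ a → q ^ suc (suc a) * (1ℚ + cSum a κ))
          ≡⟨ Σ<-cong P (λ a _ → solve 2 (λ t w → t :* (con 1ℚ :+ w) := t :+ t :* w)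
                                        refl (q ^ suc (suc a)) (cSum a κ)) ⟩
        Σ< P (λ a → q * (q * q ^ a) + q ^ suc (suc a) * cSum a κ)
          ≡⟨ Σ<-+ P _ _ ⟩
        Σ< P (λ a → q * (q * q ^ a)) + Σ< P (λ a → q ^ suc (suc a) * cSum a κ)
          ≡⟨ cong₂ _+_ powers (Σ<-q^-*-cSum P κ) ⟩
        q * (q * qint q P) + C ∎
        where
        powers : Σ< P (λ a → q * (q * q ^ a)) ≡ q * (q * qint q P)
        powers = begin
          Σ< P (λ a → q * (q * q ^ a)) ≡⟨ Σ<-*ˡ P q _ ⟩
          q * Σ< P (λ a → q * q ^ a)   ≡⟨ cong (q *_) (Σ<-*ˡ P q (q ^_)) ⟩
          q * (q * Σ< P (q ^_))        ≡⟨ cong (λ t → q * (q * t)) (qint≡Σ< P) ⟨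
          q * (q * qint q P)           ∎

    G≡closedForm : ∀ n p → G (suc p) 0 (suc n) ≡ closedForm p (suc n)
    G≡closedForm zero p = cong (1ℚ +_) (sym (trans (Σ<-cong p K⁺₁-term) (Σ<-zero p)))
      where
      K⁺₁-term : ∀ i → i <ℕ p → invFact i * c⁺ (p ∸ suc i) * K⁺ 1 i ≡ 0ℚ
      K⁺₁-term i _ =
        trans (cong (invFact i * c⁺ (p ∸ suc i) *_) (K-1 (suc i))) (ℚP.*-zeroʳ (invFact i * c⁺ (p ∸ suc i)))
    G≡closedForm (suc n) p = begin
      G (suc p) 0 (suc (suc n))
        ≡⟨ G-recurrence (suc p) 0 (suc n) ⟩
      qint q (suc p) * G (suc p) 0 (suc n) - Σ< p (λ r → q ^ suc r * G r 0 (suc n))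
        ≡⟨ cong₂ (λ u v → qint q (suc p) * u - v) (G≡closedForm n p) (earlier p) ⟩
      qint q (suc p) * closedForm p (suc n) - Σ< (pred p) (λ a → q ^ suc (suc a) * closedForm a (suc n))
        ≡⟨ closedForm-recurrence p n ⟨
      closedForm p (suc (suc n)) ∎
      where
      earlier : ∀ p → Σ< p (λ r → q ^ suc r * G r 0 (suc n))
                    ≡ Σ< (pred p) (λ a → q ^ suc (suc a) * closedForm a (suc n))
      earlier zero    = refl
      earlier (suc p) = begin
        Σ< (suc p) (λ r → q ^ suc r * G r 0 (suc n))
          ≡⟨ Σ<-head p _ ⟩
        q ^ 1 * G 0 0 (suc n) + Σ< p (λ a → q ^ suc (suc a) * G (suc a) 0 (suc n))
          ≡⟨ cong₂ _+_ (solve 2 (λ q g → q :* (con 0ℚ :* g :+ con 0ℚ) := con 0ℚ) refl (q ^ 1) (G 0 0 n))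
                       (Σ<-cong p (λ a _ → cong (q ^ suc (suc a) *_) (G≡closedForm n a))) ⟩
        0ℚ + Σ< p (λ a → q ^ suc (suc a) * closedForm a (suc n))
          ≡⟨ ℚP.+-identityˡ _ ⟩
        Σ< p (λ a → q ^ suc (suc a) * closedForm a (suc n)) ∎

    G≡RHS : ∀ p n → G (suc p) 0 (suc n) ≡ RHS q (suc (suc p)) (suc n)
    G≡RHS p n = trans (G≡closedForm n p) (sym (RHS≡closedForm p (suc n)))

theorem4p5 : (k n : ℕ) → 3 ≤ℕ k → 1 ≤ℕ n → (q : ℚ) → 0ℚ ≤ℚ q →
    (L : List (List ℕ)) → Unique L →
    (∀ w → (w ∈ L) ⇔ (IsRGF w × length w ≡ n × Avoids w (incr k))) →
    LSsum q L ≡ RHS q k n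
theorem4p5 (suc (suc p)) (suc n) (s≤s (s≤s _)) (s≤s z≤n) q q≥0 L L-unique L-spec = begin
  LSsum q L                                       ≡⟨ sumℚ-↭ (λ w → q ^ ls w) L↭ext ⟩
  sumℚ (map (weight q []) (ext (suc p) 0 (suc n))) ≡⟨ sum-weight-ext q (suc p) 0 (suc n) Spans-[] ⟩
  G q (suc p) 0 (suc n)                           ≡⟨ G≡RHS q q≥0 p n ⟩
  RHS q (suc (suc p)) (suc n)                     ∎
  where
  L↭ext : L ↭ ext (suc p) 0 (suc n)
  L↭ext = ∼bag⇒↭ (unique∧set⇒bag L-unique (ext-unique (suc p) 0 (suc n))
                    (λ {w} → ⇔.trans (L-spec w) (⇔.sym (∈-ext⇔avoids-incr (suc p) (suc n) w))))
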